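{- Let $\tau$ be a word of $n-1$ distinct integers, and let $p,q$ be distinct integers not occurring in $\tau$. For $j\in\{1,\dots,n\}$ let $\tau_j^p$ denote the word of length $n$ obtained by inserting $p$ into $\tau$ at position $j$. Then the first $j$ entries of $MIS(\tau_j^p,q)$ are a permutation (rearrangement) of the set $\{x+\chi(q>p) : x \text{ is one of the first } j \text{ entries of } MIS(\tau,p)\}$.
   Context: For a word $w=w(1)\cdots w(m)$ of distinct integers, $\mathrm{maj}(w)=\sum_{i=1}^{m-1} i\,\chi(w(i)>w(i+1))$, where $\chi(A)=1$ if $A$ is true and $0$ otherwise. For a word $\sigma$ of length $m-1$ of distinct integers, an integer $r$ not occurring in $\sigma$, and $k\in\{1,\dots,m\}$, let $\sigma_k^r$ be the word obtained by inserting $r$ in the $k$-th position (i.e. immediately before $\sigma(k)$, or at the right end if $k=m$), so that $r$ is the $k$-th letter of $\sigma_k^r$. Define $mi(\sigma,k,r)=\mathrm{maj}(\sigma_k^r)-\mathrm{maj}(\sigma)$ and the major increment sequence $MIS(\sigma,r)=(mi(\sigma,1,r),\dots,mi(\sigma,m,r))$. -}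

module Defs where

open import Data.Nat using (ℕ; zero; suc; _+_; _*_; _∸_)
open import Data.Integer as ℤ using (ℤ; +_)
open import Data.List using (List; []; _∷_; _++_; take; drop; length; map; upTo)
open import Relation.Nullary.Decidable using (⌊_⌋)
open import Data.Bool using (Bool; true; false; if_then_else_)

χ> : ℤ → ℤ → ℕ
χ> a b = if ⌊ b ℤ.<? a ⌋ then 1 else 0

-- maj from position i onward: sum over consecutive pairs (w(i),w(i+1)) of i·χ(w(i)>w(i+1)),
-- where the head of the list sits at position i
majFrom : ℕ → List ℤ → ℕ
majFrom i []             = 0
majFrom i (a ∷ [])       = 0
majFrom i (a ∷ b ∷ w)    = i * χ> a b + majFrom (suc i) (b ∷ w)

-- maj(w) = Σ_{i=1}^{m-1} i χ(w(i) > w(i+1)), positions 1-indexed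
maj : List ℤ → ℕ
maj w = majFrom 1 w

-- σ_k^r : insert r so that it becomes the k-th letter (k ∈ {1,…,length σ + 1})
insertAt : ℤ → ℕ → List ℤ → List ℤ
insertAt r k σ = take (k ∸ 1) σ ++ r ∷ drop (k ∸ 1) σ

mi : List ℤ → ℕ → ℤ → ℤ
mi σ k r = + maj (insertAt r k σ) ℤ.- + maj σ

MIS : List ℤ → ℤ → List ℤ
MIS σ r = map (λ i → mi σ (suc i) r) (upTo (suc (length σ)))

module Submission where

-- Fix a word σ and a letter r ∉ σ, and write e(k) = mi(σ,k+1,r).
-- For j ≤ |σ| the first j+1 major increments e(0),…,e(j) are a permutation of the
-- interval {c, c+1, …, c+j} with c = des(r ∷ drop j σ), the number of descents of
-- the word r followed by the suffix of σ after its first j letters.  Induction on j: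
-- e(0) = des(r ∷ σ) because prepending r shifts every descent one place to the right,
-- and when σ = u ++ x ∷ t with |u| = j, moving r from just before x to just after x
-- changes maj only locally; a case analysis on the relative order of x, r and the
-- head of t (two "triangle identities" for χ>) shows that e(j+1) either extends the
-- interval at the top (c+j+1, c unchanged) or at the bottom (c-1, c decreases).
--
-- The theorem follows by applying this twice: to σ = τ_j^p with r = q, whose relevant
-- suffix is p ∷ drop (j-1) τ, and to τ with r = p.  The two intervals have the same
-- length and their lower ends differ by des(q ∷ p ∷ s) - des(p ∷ s) = χ(q > p).

open import Defs

module MajorIncrements where

  open import Data.Nat using (ℕ; zero; suc; _+_; _*_; _∸_; _≤_; _<_; s≤s)
  open import Data.Nat.Properties
    using (+-comm; +-assoc; +-suc; +-identityʳ; *-identityʳ; *-zeroʳ; +-cancelʳ-≡;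
           m≤m+n; m+n∸m≡n; m≤n⇒m⊓n≡m; ≤-trans; n≤1+n)
  open import Data.Nat.Tactic.RingSolver using (solve-∀)
  open import Data.Integer as ℤ using (ℤ; +_)
  open import Data.Integer.Properties as ℤ using ([+m]-[+n]≡m⊖n; ≤-⊖)
  open import Data.List using (List; []; _∷_; _++_; [_]; _∷ʳ_; take; drop; length;
                               map; applyUpTo)
  open import Data.List.Properties
    using (take++drop≡id; length-take; map-upTo; applyUpTo-∷ʳ)
  open import Data.List.Membership.Propositional using (_∈_; _∉_)
  open import Data.List.Membership.Propositional.Properties using (∈-++⁺ʳ)
  open import Data.List.Relation.Unary.Any using (here)
  open import Data.List.Relation.Binary.Permutation.Propositional
    using (_↭_; ↭-reflexive; ↭-sym; module PermutationReasoning)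
  open import Data.List.Relation.Binary.Permutation.Propositional.Properties
    using (++⁺ʳ; ∷↭∷ʳ; shift)
  open import Data.Product using (Σ-syntax; _,_)
  open import Data.Sum using (_⊎_; inj₁; inj₂)
  open import Data.Empty using (⊥-elim)
  open import Relation.Nullary using (yes; no)
  open import Relation.Binary.PropositionalEquality
    using (_≡_; _≢_; refl; sym; trans; cong; cong₂; subst; module ≡-Reasoning)

  χ>-complement : ∀ {a b} → a ≢ b → χ> a b + χ> b a ≡ 1
  χ>-complement {a} {b} a≢b with b ℤ.<? a | a ℤ.<? b
  ... | yes b<a | yes a<b = ⊥-elim (ℤ.<-asym a<b b<a)
  ... | yes _   | no _    = refl
  ... | no _    | yes _   = refl
  ... | no b≮a  | no a≮b  = ⊥-elim (a≢b (ℤ.≤-antisym (ℤ.≮⇒≥ b≮a) (ℤ.≮⇒≥ a≮b)))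

  χ>-asym : ∀ a b → χ> a b ≡ 0 ⊎ χ> b a ≡ 0
  χ>-asym a b with b ℤ.<? a | a ℤ.<? b
  ... | no _    | _       = inj₁ refl
  ... | yes _   | no _    = inj₂ refl
  ... | yes b<a | yes a<b = ⊥-elim (ℤ.<-asym a<b b<a)

  -- For any three integers x, r, y one of two "triangle identities" between the
  -- descent indicators holds.  This is the whole case analysis behind the main step.
  χ>-triangle : ∀ x r y → χ> r y ≡ χ> x y + χ> r x ⊎ χ> x y ≡ χ> x r + χ> r y
  χ>-triangle x r y with y ℤ.<? r | y ℤ.<? x | x ℤ.<? r | r ℤ.<? x
  ... | yes _   | no _    | yes _   | _       = inj₁ refl
  ... | yes y<r | no y≮x  | no x≮r  | _       =
    ⊥-elim (x≮r (ℤ.≤-<-trans (ℤ.≮⇒≥ y≮x) y<r))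
  ... | yes _   | yes _   | no _    | _       = inj₁ refl
  ... | yes _   | yes _   | yes _   | no _    = inj₂ refl
  ... | yes _   | yes _   | yes x<r | yes r<x = ⊥-elim (ℤ.<-asym x<r r<x)
  ... | no _    | no _    | no _    | _       = inj₁ refl
  ... | no _    | no _    | yes _   | no _    = inj₂ refl
  ... | no _    | no _    | yes x<r | yes r<x = ⊥-elim (ℤ.<-asym x<r r<x)
  ... | no _    | yes _   | _       | yes _   = inj₂ refl
  ... | no y≮r  | yes y<x | _       | no r≮x  =
    ⊥-elim (r≮x (ℤ.≤-<-trans (ℤ.≮⇒≥ y≮r) y<x))

  headDescent : ℤ → List ℤ → ℕ
  headDescent a []      = 0
  headDescent a (y ∷ _) = χ> a y

  des : List ℤ → ℕ
  des []      = 0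
  des (x ∷ w) = headDescent x w + des w

  -- The triangle identities, with the empty word playing the role of +∞.
  headDescent-triangle : ∀ x r t →
    headDescent r t ≡ headDescent x t + χ> r x ⊎ headDescent x t ≡ χ> x r + headDescent r t
  headDescent-triangle x r (y ∷ _) = χ>-triangle x r y
  headDescent-triangle x r [] with χ>-asym r x
  ... | inj₁ r≯x = inj₁ (sym r≯x)
  ... | inj₂ x≯r = inj₂ (sym (trans (+-identityʳ _) x≯r))

  headDescent-++ : ∀ a u (x : ℤ) w w′ → headDescent a (u ++ x ∷ w) ≡ headDescent a (u ++ x ∷ w′)
  headDescent-++ a []      x w w′ = refl
  headDescent-++ a (_ ∷ _) x w w′ = refl

  majFrom-∷ : ∀ i a w → majFrom i (a ∷ w) ≡ i * headDescent a w + majFrom (suc i) w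
  majFrom-∷ i a []      = sym (trans (+-identityʳ _) (*-zeroʳ i))
  majFrom-∷ i a (_ ∷ _) = refl

  -- Shifting every position one place to the right adds each descent once more.
  majFrom-shift : ∀ i w → majFrom (suc i) w ≡ majFrom i w + des w
  majFrom-shift i []          = refl
  majFrom-shift i (a ∷ [])    = refl
  majFrom-shift i (a ∷ b ∷ w) rewrite majFrom-shift (suc i) (b ∷ w) =
    rearrange (χ> a b) i (majFrom (suc i) (b ∷ w)) (des (b ∷ w))
    where
    rearrange : ∀ c i m d → c + i * c + (m + d) ≡ i * c + m + (c + d)
    rearrange = solve-∀

  maj-∷ : ∀ r σ → maj (r ∷ σ) ≡ maj σ + des (r ∷ σ)
  maj-∷ r σ rewrite majFrom-∷ 1 r σ | majFrom-shift 1 σ =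
    rearrange (headDescent r σ) (majFrom 1 σ) (des σ)
    where
    rearrange : ∀ h m d → 1 * h + (m + d) ≡ m + (h + d)
    rearrange = solve-∀

  majFrom-split : ∀ i u x w →
    majFrom i (u ++ x ∷ w) ≡ majFrom i (u ++ [ x ]) + majFrom (i + length u) (x ∷ w)
  majFrom-split i []      x w = cong (λ k → majFrom k (x ∷ w)) (sym (+-identityʳ i))
  majFrom-split i (a ∷ u) x w = begin
    majFrom i (a ∷ u ++ x ∷ w)
      ≡⟨ majFrom-∷ i a (u ++ x ∷ w) ⟩
    i * headDescent a (u ++ x ∷ w) + majFrom (suc i) (u ++ x ∷ w)
      ≡⟨ cong₂ (λ h m → i * h + m) (headDescent-++ a u x w []) (majFrom-split (suc i) u x w) ⟩
    i * headDescent a (u ++ [ x ]) + (majFrom (suc i) (u ++ [ x ]) + majFrom (suc i + length u) (x ∷ w))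
      ≡⟨ sym (+-assoc (i * headDescent a (u ++ [ x ])) _ _) ⟩
    i * headDescent a (u ++ [ x ]) + majFrom (suc i) (u ++ [ x ]) + majFrom (suc i + length u) (x ∷ w)
      ≡⟨ cong₂ _+_ (sym (majFrom-∷ i a (u ++ [ x ])))
                   (cong (λ k → majFrom k (x ∷ w)) (sym (+-suc i (length u)))) ⟩
    majFrom i (a ∷ u ++ [ x ]) + majFrom (i + length (a ∷ u)) (x ∷ w) ∎
    where
    open ≡-Reasoning

  majFrom-insert-local : ∀ k x r t →
    majFrom k (x ∷ r ∷ t) + k * headDescent x t
      ≡ majFrom k (x ∷ t) + des t + k * χ> x r + suc k * headDescent r t
  majFrom-insert-local k x r t
    rewrite majFrom-∷ (suc k) r t | majFrom-∷ k x t | majFrom-shift (suc k) t =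
    rearrange k (χ> x r) (headDescent r t) (headDescent x t) (majFrom (suc k) t) (des t)
    where
    rearrange : ∀ k X B A m d → k * X + (suc k * B + (m + d)) + k * A ≡ k * A + m + d + k * X + suc k * B
    rearrange = solve-∀

  -- The same change inside a longer word u ++ x ∷ t: by majFrom-split only the
  -- window starting at x (position i + |u|) is affected.
  majFrom-insert : ∀ i u x r t → let k = i + length u in
    majFrom i (u ++ x ∷ r ∷ t) + k * headDescent x t
      ≡ majFrom i (u ++ x ∷ t) + des t + k * χ> x r + suc k * headDescent r t
  majFrom-insert i u x r t = begin
    majFrom i (u ++ x ∷ r ∷ t) + k * headDescent x t
      ≡⟨ cong (_+ k * headDescent x t) (majFrom-split i u x (r ∷ t)) ⟩
    P + majFrom k (x ∷ r ∷ t) + k * headDescent x t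
      ≡⟨ +-assoc P _ _ ⟩
    P + (majFrom k (x ∷ r ∷ t) + k * headDescent x t)
      ≡⟨ cong (λ m → P + m) (majFrom-insert-local k x r t) ⟩
    P + (majFrom k (x ∷ t) + des t + k * χ> x r + suc k * headDescent r t)
      ≡⟨ reassociate P (majFrom k (x ∷ t)) (des t) (k * χ> x r) (suc k * headDescent r t) ⟩
    P + majFrom k (x ∷ t) + des t + k * χ> x r + suc k * headDescent r t
      ≡⟨ cong (λ m → m + des t + k * χ> x r + suc k * headDescent r t) (sym (majFrom-split i u x t)) ⟩
    majFrom i (u ++ x ∷ t) + des t + k * χ> x r + suc k * headDescent r t ∎
    where
    open ≡-Reasoning
    k = i + length u
    P = majFrom i (u ++ [ x ])
    reassociate : ∀ P Q d X B → P + (Q + d + X + B) ≡ P + Q + d + X + B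
    reassociate = solve-∀

  drop-nonempty : ∀ j (σ : List ℤ) → j < length σ →
                  Σ[ x ∈ ℤ ] Σ[ t ∈ List ℤ ] drop j σ ≡ x ∷ t
  drop-nonempty zero    (a ∷ σ) _         = a , σ , refl
  drop-nonempty (suc j) (a ∷ σ) (s≤s j<) = drop-nonempty j σ j<

  drop-suc : ∀ j (σ : List ℤ) {x t} → drop j σ ≡ x ∷ t → drop (suc j) σ ≡ t
  drop-suc zero    (a ∷ σ) refl = refl
  drop-suc (suc j) (a ∷ σ) eq   = drop-suc j σ eq

  insertAt-after : ∀ r j σ {x t} → drop j σ ≡ x ∷ t →
                   insertAt r (suc (suc j)) σ ≡ take j σ ++ x ∷ r ∷ t
  insertAt-after r zero    (a ∷ σ) refl = refl
  insertAt-after r (suc j) (a ∷ σ) eq   = cong (a ∷_) (insertAt-after r j σ eq)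

  split-at-drop : ∀ j (σ : List ℤ) {x t} → drop j σ ≡ x ∷ t → σ ≡ take j σ ++ x ∷ t
  split-at-drop j σ eq = trans (sym (take++drop≡id j σ)) (cong (take j σ ++_) eq)

  maj-insertAfter : ∀ r j σ {x t} → j ≤ length σ → drop j σ ≡ x ∷ t →
    maj (insertAt r (suc (suc j)) σ) + suc j * headDescent x t
      ≡ maj σ + des t + suc j * χ> x r + suc (suc j) * headDescent r t
  maj-insertAfter r j σ {x} {t} j≤|σ| eq = begin
    maj (insertAt r (suc (suc j)) σ) + suc j * headDescent x t
      ≡⟨ cong (λ w → maj w + suc j * headDescent x t) (insertAt-after r j σ eq) ⟩
    maj (u ++ x ∷ r ∷ t) + suc j * headDescent x t
      ≡⟨ subst (λ k → maj (u ++ x ∷ r ∷ t) + suc k * headDescent x t ≡ rhs (u ++ x ∷ t) k)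
               |u|≡j (majFrom-insert 1 u x r t) ⟩
    rhs (u ++ x ∷ t) j
      ≡⟨ cong (λ w → rhs w j) (sym (split-at-drop j σ eq)) ⟩
    rhs σ j ∎
    where
    open ≡-Reasoning
    u = take j σ
    |u|≡j : length u ≡ j
    |u|≡j = trans (length-take j σ) (m≤n⇒m⊓n≡m j≤|σ|)
    rhs : List ℤ → ℕ → ℕ
    rhs w k = maj w + des t + suc k * χ> x r + suc (suc k) * headDescent r t

  range : ℕ → ℕ → List ℤ
  range c zero    = []
  range c (suc n) = + c ∷ range (suc c) n

  range-∷ʳ : ∀ c n → range c n ∷ʳ + (c + n) ≡ range c (suc n)
  range-∷ʳ c zero    = cong (λ m → + m ∷ []) (+-identityʳ c)
  range-∷ʳ c (suc n) =
    cong (+ c ∷_) (trans (cong (λ m → range (suc c) n ∷ʳ + m) (+-suc c n)) (range-∷ʳ (suc c) n))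

  range-shift : ∀ k c n → map (λ x → x ℤ.+ + k) (range c n) ≡ range (c + k) n
  range-shift k c zero    = refl
  range-shift k c (suc n) = cong (+ (c + k) ∷_) (range-shift k (suc c) n)

  pos-difference : ∀ {a b c} → a ≡ b + c → + a ℤ.- + b ≡ + c
  pos-difference {b = b} {c} refl =
    trans ([+m]-[+n]≡m⊖n (b + c) b) (trans (≤-⊖ (m≤m+n b c)) (cong +_ (m+n∸m≡n b c)))

  -- Growth c n c′ M M′: the increment M′ - M turns the interval range c n into
  -- range c′ (suc n), either by adding its next element on top (c′ = c) or the
  -- element just below it (c = c′ + 1).
  data Growth (c n c′ M M′ : ℕ) : Set where
    upward   : c′ ≡ c → M′ ≡ M + (c + n) → Growth c n c′ M M′
    downward : c ≡ suc c′ → M′ ≡ M + c′ → Growth c n c′ M M′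

  extend : ∀ {L c n c′ M M′} → L ↭ range c n → Growth c n c′ M M′ →
           L ∷ʳ (+ M′ ℤ.- + M) ↭ range c′ (suc n)
  extend {L} {c} {n} {M = M} {M′} L↭ (upward refl M′≡) = begin
    L ∷ʳ (+ M′ ℤ.- + M)  ≡⟨ cong (L ∷ʳ_) (pos-difference {b = M} M′≡) ⟩
    L ∷ʳ + (c + n)       ↭⟨ ++⁺ʳ _ L↭ ⟩
    range c n ∷ʳ + (c + n) ≡⟨ range-∷ʳ c n ⟩
    range c (suc n)      ∎
    where open PermutationReasoning
  extend {L} {n = n} {c′} {M} {M′} L↭ (downward refl M′≡) = begin
    L ∷ʳ (+ M′ ℤ.- + M)          ≡⟨ cong (L ∷ʳ_) (pos-difference {b = M} M′≡) ⟩
    L ∷ʳ + c′                    ↭⟨ ++⁺ʳ _ L↭ ⟩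
    range (suc c′) n ∷ʳ + c′     ↭⟨ ↭-sym (∷↭∷ʳ (+ c′) (range (suc c′) n)) ⟩
    range c′ (suc n)             ∎
    where open PermutationReasoning

  -- With A = χ(x > t₁), B = χ(r > t₁),
  -- X = χ(x > r), Y = χ(r > x), d = des t and the relation of maj-insertAfter, each
  -- triangle identity yields one way of growing the interval.
  growth : ∀ {M M′} n d A B X Y → X + Y ≡ 1 → B ≡ A + Y ⊎ A ≡ X + B →
           M′ + n * A ≡ M + d + n * X + suc n * B → Growth (Y + (A + d)) n (B + d) M M′
  growth {M} {M′} n d A .(A + Y) X Y X+Y≡1 (inj₁ refl) eq =
    upward (rearrange A Y d) (+-cancelʳ-≡ (n * A) M′ _ (begin
      M′ + n * A
        ≡⟨ eq ⟩
      M + d + n * X + suc n * (A + Y)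
        ≡⟨ collect M d n A X Y ⟩
      M + (Y + (A + d) + n * (X + Y)) + n * A
        ≡⟨ cong (λ s → M + (Y + (A + d) + n * s) + n * A) X+Y≡1 ⟩
      M + (Y + (A + d) + n * 1) + n * A
        ≡⟨ cong (λ m → M + (Y + (A + d) + m) + n * A) (*-identityʳ n) ⟩
      M + (Y + (A + d) + n) + n * A ∎))
    where
    open ≡-Reasoning
    rearrange : ∀ A Y d → A + Y + d ≡ Y + (A + d)
    rearrange = solve-∀
    collect : ∀ M d n A X Y → M + d + n * X + suc n * (A + Y) ≡ M + (Y + (A + d) + n * (X + Y)) + n * A
    collect = solve-∀
  growth {M} {M′} n d .(X + B) B X Y X+Y≡1 (inj₂ refl) eq =
    downward (trans (rearrange X Y B d) (cong (_+ (B + d)) X+Y≡1))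
             (+-cancelʳ-≡ (n * (X + B)) M′ _ (trans eq (collect M d n B X)))
    where
    rearrange : ∀ X Y B d → Y + (X + B + d) ≡ X + Y + (B + d)
    rearrange = solve-∀
    collect : ∀ M d n B X → M + d + n * X + suc n * B ≡ M + (B + d) + n * (X + B)
    collect = solve-∀

  increment : List ℤ → ℤ → ℕ → ℤ
  increment σ r i = mi σ (suc i) r

  increments-interval : ∀ σ r → r ∉ σ → ∀ j → j ≤ length σ →
    applyUpTo (increment σ r) (suc j) ↭ range (des (r ∷ drop j σ)) (suc j)
  increments-interval σ r r∉σ zero _ = ↭-reflexive (cong (_∷ []) (pos-difference {b = maj σ} (maj-∷ r σ)))
  increments-interval σ r r∉σ (suc j) j<|σ| with drop-nonempty j σ j<|σ|
  ... | x , t , eq = begin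
    applyUpTo (increment σ r) (suc (suc j))
      ≡⟨ sym (applyUpTo-∷ʳ (increment σ r) (suc j)) ⟩
    applyUpTo (increment σ r) (suc j) ∷ʳ increment σ r (suc j)
      ↭⟨ extend previous step ⟩
    range (des (r ∷ t)) (suc (suc j))
      ≡⟨ cong (λ s → range (des (r ∷ s)) (suc (suc j))) (sym (drop-suc j σ eq)) ⟩
    range (des (r ∷ drop (suc j) σ)) (suc (suc j)) ∎
    where
    open PermutationReasoning
    j≤|σ| : j ≤ length σ
    j≤|σ| = ≤-trans (n≤1+n j) j<|σ|
    previous : applyUpTo (increment σ r) (suc j) ↭ range (des (r ∷ x ∷ t)) (suc j)
    previous = subst (λ s → applyUpTo (increment σ r) (suc j) ↭ range (des (r ∷ s)) (suc j)) eq
                     (increments-interval σ r r∉σ j j≤|σ|)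
    x≢r : x ≢ r
    x≢r refl = r∉σ (subst (x ∈_) (sym (split-at-drop j σ eq)) (∈-++⁺ʳ (take j σ) (here refl)))
    step : Growth (des (r ∷ x ∷ t)) (suc j) (des (r ∷ t)) (maj σ) (maj (insertAt r (suc (suc j)) σ))
    step = growth (suc j) (des t) _ _ _ _ (χ>-complement x≢r) (headDescent-triangle x r t)
                  (maj-insertAfter r j σ j≤|σ| eq)

  take-applyUpTo : ∀ {A : Set} (f : ℕ → A) j m → j ≤ m → take j (applyUpTo f m) ≡ applyUpTo f j
  take-applyUpTo f zero    m       _          = refl
  take-applyUpTo f (suc j) (suc m) (s≤s j≤m) = cong (f 0 ∷_) (take-applyUpTo (λ i → f (suc i)) j m j≤m)

  MIS-prefix-interval : ∀ σ r → r ∉ σ → ∀ j → j ≤ length σ →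
    take (suc j) (MIS σ r) ↭ range (des (r ∷ drop j σ)) (suc j)
  MIS-prefix-interval σ r r∉σ j j≤|σ| = begin
    take (suc j) (MIS σ r)
      ≡⟨ cong (take (suc j)) (map-upTo (increment σ r) (suc (length σ))) ⟩
    take (suc j) (applyUpTo (increment σ r) (suc (length σ)))
      ≡⟨ take-applyUpTo (increment σ r) (suc j) _ (s≤s j≤|σ|) ⟩
    applyUpTo (increment σ r) (suc j)
      ↭⟨ increments-interval σ r r∉σ j j≤|σ| ⟩
    range (des (r ∷ drop j σ)) (suc j) ∎
    where open PermutationReasoning

  insertAt-↭ : ∀ p j τ → insertAt p j τ ↭ p ∷ τ
  insertAt-↭ p j τ = begin
    take k τ ++ p ∷ drop k τ   ↭⟨ shift p (take k τ) (drop k τ) ⟩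
    p ∷ take k τ ++ drop k τ   ≡⟨ cong (p ∷_) (take++drop≡id k τ) ⟩
    p ∷ τ                      ∎
    where
    open PermutationReasoning
    k = j ∸ 1

  drop-insertAt : ∀ p j τ → j ≤ length τ → drop j (insertAt p (suc j) τ) ≡ p ∷ drop j τ
  drop-insertAt p zero    τ       _         = refl
  drop-insertAt p (suc j) (a ∷ τ) (s≤s j≤) = drop-insertAt p j τ j≤

  -- Putting q in front of p ∷ s adds exactly the descent χ(q > p), so the interval
  -- starting at des (q ∷ p ∷ s) is the one starting at des (p ∷ s) shifted by χ(q > p).
  range-des-∷ : ∀ q p s n →
                range (des (q ∷ p ∷ s)) n ≡ map (λ x → x ℤ.+ + χ> q p) (range (des (p ∷ s)) n)
  range-des-∷ q p s n = trans (cong (λ c → range c n) (+-comm (χ> q p) (des (p ∷ s))))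
                              (sym (range-shift (χ> q p) (des (p ∷ s)) n))

open MajorIncrements
open import Data.Nat using (ℕ; suc; _≤_; s≤s)
open import Data.Nat.Properties using (≤-trans; n≤1+n)
open import Data.Integer using (ℤ; +_; _+_)
open import Data.List using (List; _∷_; length; take; drop; map)
open import Data.List.Membership.Propositional using (_∉_)
open import Data.List.Relation.Unary.Any using (here; there)
open import Data.List.Relation.Unary.Unique.Propositional using (Unique)
open import Data.List.Relation.Binary.Permutation.Propositional using (_↭_; ↭-sym; module PermutationReasoning)
open import Data.List.Relation.Binary.Permutation.Propositional.Properties using (map⁺; ↭-length; ∈-resp-↭)
open import Relation.Binary.PropositionalEquality using (_≡_; _≢_; refl; sym; cong; subst)

lemma4p1 : (n : ℕ) (τ : List ℤ) (p q : ℤ) (j : ℕ) →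
           suc (length τ) ≡ n →
           Unique τ → p ∉ τ → q ∉ τ → p ≢ q →
           1 ≤ j → j ≤ n →
           take j (MIS (insertAt p j τ) q)
             ↭ map (λ x → x + (+ χ> q p)) (take j (MIS τ p))
lemma4p1 _ τ p q (suc j) refl _ p∉τ q∉τ p≢q (s≤s _) (s≤s j≤|τ|) = begin
  take (suc j) (MIS σ q)
    ↭⟨ MIS-prefix-interval σ q q∉σ j j≤|σ| ⟩
  range (des (q ∷ drop j σ)) (suc j)
    ≡⟨ cong (λ w → range (des (q ∷ w)) (suc j)) (drop-insertAt p j τ j≤|τ|) ⟩
  range (des (q ∷ p ∷ s)) (suc j)
    ≡⟨ range-des-∷ q p s (suc j) ⟩
  map (λ x → x + (+ χ> q p)) (range (des (p ∷ s)) (suc j))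
    ↭⟨ map⁺ _ (↭-sym (MIS-prefix-interval τ p p∉τ j j≤|τ|)) ⟩
  map (λ x → x + (+ χ> q p)) (take (suc j) (MIS τ p)) ∎
  where
  open PermutationReasoning
  σ = insertAt p (suc j) τ
  s = drop j τ
  j≤|σ| : j ≤ length σ
  j≤|σ| = subst (j ≤_) (sym (↭-length (insertAt-↭ p (suc j) τ))) (≤-trans j≤|τ| (n≤1+n _))
  q∉σ : q ∉ σ
  q∉σ q∈σ with ∈-resp-↭ (insertAt-↭ p (suc j) τ) q∈σ
  ... | here q≡p   = p≢q (sym q≡p)
  ... | there q∈τ = q∉τ q∈τ
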